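{- Let $m,n$ be positive integers and $d=\gcd(m,n)$. Then $$C(m,n)=\sum_{i=1}^d\frac{i}{d}\,A_{(\frac{i}{d}m,\frac{i}{d}n)}\,C\!\left(\tfrac{d-i}{d}m,\tfrac{d-i}{d}n\right),$$ where $A_{(u,v)}=\frac{1}{u+v}\binom{u+v}{v}$ and $C(0,0)=1$.
   Context: A lattice path from $(0,0)$ to $(m,n)$ is a path of unit steps right or up in $\mathbb{Z}^2$; it is a Dyck path if all its lattice points lie in the region $y\le\frac{n}{m}x$. $C(m,n)$ denotes the number of Dyck paths from $(0,0)$ to $(m,n)$, with the convention $C(0,0)=1$ (the empty path). -}

module Defs where

open import Data.Nat using (ℕ; zero; suc; _+_; _*_; _≤_)
open import Data.Nat.Properties using (_≤?_)
import Data.Nat.DivMod as ND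
open import Data.Nat.Combinatorics using (_C_)
open import Data.List using (List; []; _∷_; map; _++_; length; filter)
open import Data.Integer using (+_)
open import Data.Rational using (ℚ; 0ℚ; _/_) renaming (_+_ to _+ℚ_; _*_ to _*ℚ_)
open import Relation.Nullary using (Dec; yes; no)

data Step : Set where
  R U : Step   -- R = (1,0), U = (0,1)

lattice-paths : ℕ → ℕ → List (List Step)
lattice-paths zero    zero    = [] ∷ []
lattice-paths zero    (suc n) = map (U ∷_) (lattice-paths zero n)
lattice-paths (suc m) zero    = map (R ∷_) (lattice-paths m zero)
lattice-paths (suc m) (suc n) =
  map (R ∷_) (lattice-paths m (suc n)) ++ map (U ∷_) (lattice-paths (suc m) n)

data AllBelow (m n : ℕ) : ℕ → ℕ → List Step → Set where
  done : ∀ {x y} → m * y ≤ n * x → AllBelow m n x y []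
  stepR : ∀ {x y p} → m * y ≤ n * x → AllBelow m n (suc x) y p → AllBelow m n x y (R ∷ p)
  stepU : ∀ {x y p} → m * y ≤ n * x → AllBelow m n x (suc y) p → AllBelow m n x y (U ∷ p)

allBelow? : ∀ m n x y (p : List Step) → Dec (AllBelow m n x y p)
allBelow? m n x y p with (m * y) ≤? (n * x)
allBelow? m n x y p | no ¬h = no λ { (done h) → ¬h h ; (stepR h _) → ¬h h ; (stepU h _) → ¬h h }
allBelow? m n x y [] | yes h = yes (done h)
allBelow? m n x y (R ∷ p) | yes h with allBelow? m n (suc x) y p
... | yes q = yes (stepR h q)
... | no ¬q = no λ { (stepR _ q) → ¬q q }
allBelow? m n x y (U ∷ p) | yes h with allBelow? m n x (suc y) p
... | yes q = yes (stepU h q)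
... | no ¬q = no λ { (stepU _ q) → ¬q q }

-- a lattice path to (m,n) is a Dyck path if all its lattice points lie in y ≤ (n/m) x
IsDyck : ℕ → ℕ → List Step → Set
IsDyck m n p = AllBelow m n 0 0 p

isDyck? : ∀ m n (p : List Step) → Dec (IsDyck m n p)
isDyck? m n = allBelow? m n 0 0

Cat : ℕ → ℕ → ℕ
Cat m n = length (filter (isDyck? m n) (lattice-paths m n))

-- natural-number division p / q (only used when q ≠ 0 and q ∣ p)
_div_ : ℕ → ℕ → ℕ
p div zero = 0
p div suc q = p ND./ suc q

-- rational p / q (only used with q ≠ 0)
frac : ℕ → ℕ → ℚ
frac p zero = 0ℚ
frac p (suc q) = (+ p) / suc q

A : ℕ → ℕ → ℚ
A u v = frac ((u + v) C v) (u + v)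

sum1to : ℕ → (ℕ → ℚ) → ℚ
sum1to zero f = 0ℚ
sum1to (suc d) f = sum1to d f +ℚ f (suc d)

fromℕ : ℕ → ℚ
fromℕ k = frac k 1

-- Write m = d a and n = d b with a, b coprime, and let a step R raise the height by b and a
-- step U lower it by a. A lattice path to (m, n) is then a Dyck path iff its height never drops
-- below 0, and a word of length N = d (a + b) ends at (m, n) iff it ends at height 0. Let D_L
-- count the words of length L that stay at or above 0 and end at 0, and B_L all words of length L
-- that end at 0. Cutting a Dyck word of length N at each of its N positions before the end,
-- splitting the first piece at its last return to 0, and recognising what remains as a closed walk
-- rotated around its last minimum gives the cycle-lemma identity N D_N = Σ_{L=1}^{N} B_L D_{N-L}.
-- Coprimality makes B_L vanish unless (a + b) ∣ L, while B_{i(a+b)} = binom(i(a+b), ib) and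
-- D_{i(a+b)} = C(ia, ib); dividing by N gives the claim, since binom(i(a+b), ib) / N = (i/d) A_(ia,ib).

module Submission where

open import Defs
open import Data.Bool using (if_then_else_)
open import Data.Nat
  using (ℕ; zero; suc; _+_; _*_; _∸_; _/_; _≤_; _≤?_; _≟_; z≤n; s≤s;
         NonZero; >-nonZero; >-nonZero⁻¹; ≢-nonZero; ≢-nonZero⁻¹)
import Data.Nat.Properties as ℕₚ
open import Data.Nat.Tactic.RingSolver using (solve-∀)
open import Algebra.Properties.CommutativeSemigroup ℕₚ.+-commutativeSemigroup using (interchange)
open import Data.List using (List; []; _∷_; _++_; length; map; filter)
open import Data.List.Properties using (map-∘; map-++)
open import Data.Nat.ListAction using (sum)
open import Data.Nat.ListAction.Properties using (sum-++)
open import Data.Product using (_×_; _,_; uncurry; proj₂)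
open import Data.Nat.Combinatorics using (_C_; nCk+nC[k+1]≡[n+1]C[k+1])
open import Data.Nat.Divisibility using (_∣_; divides; ∣m+n∣m⇒∣n; n∣m*n; ∣⇒≤)
open import Data.Nat.Coprimality as Coprimality using (Coprime; coprime-+; coprime-divisor; coprime-/gcd)
open import Data.Nat.DivMod using (m*n/n≡m; m/n*n≡m)
open import Data.Nat.GCD using (gcd; gcd[m,n]∣m; gcd[m,n]∣n; gcd[m,n]≢0)
open import Function.Bundles using (_⇔_; mk⇔; Equivalence)
open import Data.Integer as ℤ using (ℤ; -_; 0ℤ; _⊓_)
import Data.Integer.Properties as ℤₚ
import Data.Integer.Tactic.RingSolver as ℤ-Solver
open import Algebra.Bundles using (AbelianGroup)
open import Algebra.Properties.Group (AbelianGroup.group ℤₚ.+-0-abelianGroup) using (inverseˡ-unique)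
open import Data.Sum using (inj₁)
open import Data.Rational using (ℚ; toℚᵘ) renaming (_+_ to _+ℚ_; _*_ to _*ℚ_)
import Data.Rational.Properties as ℚₚ
open import Data.Rational.Unnormalised using (mkℚᵘ; *≡*; _≃_)
import Data.Rational.Unnormalised.Properties as ℚᵘₚ
open import Relation.Nullary using (Dec; yes; no; does; _×-dec_; ¬_; contradiction)
open import Relation.Nullary.Decidable using (does-⇔)
open import Relation.Binary.PropositionalEquality
  using (_≡_; refl; sym; trans; cong; cong₂; subst; subst₂; module ≡-Reasoning)
open ≡-Reasoning

𝟙 : {P : Set} → Dec P → ℕ
𝟙 P? = if does P? then 1 else 0

𝟙-cong : {P Q : Set} (P? : Dec P) (Q? : Dec Q) → P ⇔ Q → 𝟙 P? ≡ 𝟙 Q?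
𝟙-cong P? Q? P⇔Q = cong (λ b → if b then 1 else 0) (does-⇔ P⇔Q P? Q?)

𝟙-true : {P : Set} (P? : Dec P) → P → 𝟙 P? ≡ 1
𝟙-true (yes _) _ = refl
𝟙-true (no ¬p) p = contradiction p ¬p

𝟙-false : {P : Set} (P? : Dec P) → ¬ P → 𝟙 P? ≡ 0
𝟙-false (yes p) ¬p = contradiction p ¬p
𝟙-false (no _)  _  = refl

𝟙-*-cong : {P : Set} (P? : Dec P) {m n : ℕ} → (P → m ≡ n) → 𝟙 P? * m ≡ 𝟙 P? * n
𝟙-*-cong (yes p) m≡n = cong (1 *_) (m≡n p)
𝟙-*-cong (no _)  _   = refl

𝟙-× : {P Q : Set} (P? : Dec P) (Q? : Dec Q) → 𝟙 (P? ×-dec Q?) ≡ 𝟙 P? * 𝟙 Q?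
𝟙-× (yes _) (yes _) = refl
𝟙-× (yes _) (no _)  = refl
𝟙-× (no _)  _       = refl

𝟙-≟-determined : ∀ r u x y → r + u ≡ x + y → 𝟙 (r ≟ x) * 𝟙 (u ≟ y) ≡ 𝟙 (u ≟ y)
𝟙-≟-determined r u x y r+u≡x+y =
  trans (sym (𝟙-× (r ≟ x) (u ≟ y)))
        (𝟙-cong (r ≟ x ×-dec u ≟ y) (u ≟ y) (mk⇔ proj₂ (λ u≡y → r≡x u≡y , u≡y)))
  where
  r≡x : u ≡ y → r ≡ x
  r≡x refl = ℕₚ.+-cancelʳ-≡ u r x r+u≡x+y

sumWords : ℕ → (List Step → ℕ) → ℕ
sumWords zero    F = F []
sumWords (suc n) F = sumWords n (λ w → F (R ∷ w)) + sumWords n (λ w → F (U ∷ w))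


sumWords-cong : ∀ n {F G : List Step → ℕ} → (∀ w → length w ≡ n → F w ≡ G w) →
                sumWords n F ≡ sumWords n G
sumWords-cong zero    F≗G = F≗G [] refl
sumWords-cong (suc n) F≗G =
  cong₂ _+_ (sumWords-cong n (λ w e → F≗G (R ∷ w) (cong suc e)))
            (sumWords-cong n (λ w e → F≗G (U ∷ w) (cong suc e)))

sumWords-zero : ∀ n {F : List Step → ℕ} → (∀ w → length w ≡ n → F w ≡ 0) → sumWords n F ≡ 0
sumWords-zero zero    F≗0 = F≗0 [] refl
sumWords-zero (suc n) F≗0 =
  cong₂ _+_ (sumWords-zero n (λ w e → F≗0 (R ∷ w) (cong suc e)))
            (sumWords-zero n (λ w e → F≗0 (U ∷ w) (cong suc e)))

sumWords-+ : ∀ n (F G : List Step → ℕ) → sumWords n (λ w → F w + G w) ≡ sumWords n F + sumWords n G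
sumWords-+ zero    F G = refl
sumWords-+ (suc n) F G =
  trans (cong₂ _+_ (sumWords-+ n _ _) (sumWords-+ n _ _))
        (interchange (sumWords n (λ w → F (R ∷ w))) (sumWords n (λ w → G (R ∷ w))) _ _)

sumWords-*ˡ : ∀ n c (F : List Step → ℕ) → sumWords n (λ w → c * F w) ≡ c * sumWords n F
sumWords-*ˡ zero    c F = refl
sumWords-*ˡ (suc n) c F =
  trans (cong₂ _+_ (sumWords-*ˡ n c _) (sumWords-*ˡ n c _)) (sym (ℕₚ.*-distribˡ-+ c _ _))

sumWords-*ʳ : ∀ n c (F : List Step → ℕ) → sumWords n (λ w → F w * c) ≡ sumWords n F * c
sumWords-*ʳ n c F = begin
  sumWords n (λ w → F w * c) ≡⟨ sumWords-cong n (λ w _ → ℕₚ.*-comm (F w) c) ⟩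
  sumWords n (λ w → c * F w) ≡⟨ sumWords-*ˡ n c F ⟩
  c * sumWords n F           ≡⟨ ℕₚ.*-comm c _ ⟩
  sumWords n F * c           ∎

sumWords-++ : ∀ a b (F : List Step → ℕ) →
              sumWords (a + b) F ≡ sumWords a (λ u → sumWords b (λ v → F (u ++ v)))
sumWords-++ zero    b F = refl
sumWords-++ (suc a) b F = cong₂ _+_ (sumWords-++ a b _) (sumWords-++ a b _)

sumWords-comm : ∀ a b (F : List Step → List Step → ℕ) →
                sumWords a (λ u → sumWords b (F u)) ≡ sumWords b (λ v → sumWords a (λ u → F u v))
sumWords-comm zero    b F = refl
sumWords-comm (suc a) b F =
  trans (cong₂ _+_ (sumWords-comm a b _) (sumWords-comm a b _)) (sym (sumWords-+ b _ _))

sumAntidiagonal : ℕ → (ℕ → ℕ → ℕ) → ℕ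
sumAntidiagonal zero    g = g 0 0
sumAntidiagonal (suc M) g = g 0 (suc M) + sumAntidiagonal M (λ i j → g (suc i) j)


sumAntidiagonal-cong : ∀ M {g h : ℕ → ℕ → ℕ} → (∀ i j → i + j ≡ M → g i j ≡ h i j) →
                       sumAntidiagonal M g ≡ sumAntidiagonal M h
sumAntidiagonal-cong zero    g≗h = g≗h 0 0 refl
sumAntidiagonal-cong (suc M) g≗h =
  cong₂ _+_ (g≗h 0 (suc M) refl) (sumAntidiagonal-cong M (λ i j e → g≗h (suc i) j (cong suc e)))

sumAntidiagonal-+ : ∀ M (g h : ℕ → ℕ → ℕ) →
  sumAntidiagonal M (λ i j → g i j + h i j) ≡ sumAntidiagonal M g + sumAntidiagonal M h
sumAntidiagonal-+ zero    g h = refl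
sumAntidiagonal-+ (suc M) g h =
  trans (cong (g 0 (suc M) + h 0 (suc M) +_) (sumAntidiagonal-+ M _ _))
        (interchange (g 0 (suc M)) (h 0 (suc M)) _ _)

sumAntidiagonal-*ˡ : ∀ M c (g : ℕ → ℕ → ℕ) →
                     sumAntidiagonal M (λ i j → c * g i j) ≡ c * sumAntidiagonal M g
sumAntidiagonal-*ˡ zero    c g = refl
sumAntidiagonal-*ˡ (suc M) c g =
  trans (cong (c * g 0 (suc M) +_) (sumAntidiagonal-*ˡ M c _)) (sym (ℕₚ.*-distribˡ-+ c _ _))

sumAntidiagonal-const : ∀ M c → sumAntidiagonal M (λ _ _ → c) ≡ suc M * c
sumAntidiagonal-const zero    c = sym (ℕₚ.+-identityʳ c)
sumAntidiagonal-const (suc M) c = cong (c +_) (sumAntidiagonal-const M c)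

sumAntidiagonal-last : ∀ M (g : ℕ → ℕ → ℕ) →
  sumAntidiagonal (suc M) g ≡ sumAntidiagonal M (λ i j → g i (suc j)) + g (suc M) 0
sumAntidiagonal-last zero    g = refl
sumAntidiagonal-last (suc M) g =
  trans (cong (g 0 (suc (suc M)) +_) (sumAntidiagonal-last M (λ i j → g (suc i) j)))
        (sym (ℕₚ.+-assoc (g 0 (suc (suc M))) _ _))

sumAntidiagonal-comm : ∀ M (g : ℕ → ℕ → ℕ) → sumAntidiagonal M g ≡ sumAntidiagonal M (λ i j → g j i)
sumAntidiagonal-comm zero    g = refl
sumAntidiagonal-comm (suc M) g = begin
  g 0 (suc M) + sumAntidiagonal M (λ i j → g (suc i) j)
    ≡⟨ cong (g 0 (suc M) +_) (sumAntidiagonal-comm M _) ⟩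
  g 0 (suc M) + sumAntidiagonal M (λ i j → g (suc j) i)
    ≡⟨ ℕₚ.+-comm (g 0 (suc M)) _ ⟩
  sumAntidiagonal M (λ i j → g (suc j) i) + g 0 (suc M)
    ≡⟨ sym (sumAntidiagonal-last M (λ i j → g j i)) ⟩
  sumAntidiagonal (suc M) (λ i j → g j i) ∎

sumAntidiagonal-assoc : ∀ M (f : ℕ → ℕ → ℕ → ℕ) →
  sumAntidiagonal M (λ j k → sumAntidiagonal j (λ x y → f x y k)) ≡
  sumAntidiagonal M (λ x r → sumAntidiagonal r (λ y k → f x y k))
sumAntidiagonal-assoc zero    f = refl
sumAntidiagonal-assoc (suc M) f = begin
  f 0 0 (suc M) + sumAntidiagonal M (λ j k → f 0 (suc j) k + sumAntidiagonal j (λ x y → f (suc x) y k))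
    ≡⟨ cong (f 0 0 (suc M) +_) (sumAntidiagonal-+ M _ _) ⟩
  f 0 0 (suc M) + (sumAntidiagonal M (λ j k → f 0 (suc j) k)
                   + sumAntidiagonal M (λ j k → sumAntidiagonal j (λ x y → f (suc x) y k)))
    ≡⟨ cong (λ z → f 0 0 (suc M) + (sumAntidiagonal M (λ j k → f 0 (suc j) k) + z))
            (sumAntidiagonal-assoc M (λ x → f (suc x))) ⟩
  f 0 0 (suc M) + (sumAntidiagonal M (λ j k → f 0 (suc j) k)
                   + sumAntidiagonal M (λ x r → sumAntidiagonal r (λ y k → f (suc x) y k)))
    ≡⟨ sym (ℕₚ.+-assoc (f 0 0 (suc M)) _ _) ⟩
  sumAntidiagonal (suc M) (λ x r → sumAntidiagonal r (λ y k → f x y k)) ∎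

sumWords-sumAntidiagonal : ∀ n M (g : List Step → ℕ → ℕ → ℕ) →
  sumWords n (λ w → sumAntidiagonal M (g w)) ≡ sumAntidiagonal M (λ i j → sumWords n (λ w → g w i j))
sumWords-sumAntidiagonal n zero    g = refl
sumWords-sumAntidiagonal n (suc M) g =
  trans (sumWords-+ n _ _) (cong (sumWords n (λ w → g w 0 (suc M)) +_) (sumWords-sumAntidiagonal n M _))

sumSplits : (List Step → List Step → ℕ) → List Step → ℕ
sumSplits F []      = F [] []
sumSplits F (s ∷ w) = F [] (s ∷ w) + sumSplits (λ a c → F (s ∷ a) c) w

sumSplits-cong : ∀ w {F G : List Step → List Step → ℕ} → (∀ a c → F a c ≡ G a c) →
                 sumSplits F w ≡ sumSplits G w
sumSplits-cong []      F≗G = F≗G [] []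
sumSplits-cong (s ∷ w) F≗G = cong₂ _+_ (F≗G [] (s ∷ w)) (sumSplits-cong w (λ a c → F≗G (s ∷ a) c))

sumWords-sumSplits : ∀ n (F : List Step → List Step → ℕ) →
  sumWords n (sumSplits F) ≡ sumAntidiagonal n (λ i j → sumWords i (λ a → sumWords j (F a)))
sumWords-sumSplits zero    F = refl
sumWords-sumSplits (suc n) F = begin
  sumWords n (λ w → F [] (R ∷ w) + sumSplits (λ a → F (R ∷ a)) w)
    + sumWords n (λ w → F [] (U ∷ w) + sumSplits (λ a → F (U ∷ a)) w)
    ≡⟨ cong₂ _+_ (sumWords-+ n _ _) (sumWords-+ n _ _) ⟩
  (sumWords n (λ w → F [] (R ∷ w)) + sumWords n (sumSplits (λ a → F (R ∷ a))))
    + (sumWords n (λ w → F [] (U ∷ w)) + sumWords n (sumSplits (λ a → F (U ∷ a))))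
    ≡⟨ interchange (sumWords n (λ w → F [] (R ∷ w))) (sumWords n (sumSplits (λ a → F (R ∷ a)))) _ _ ⟩
  sumWords (suc n) (F []) + (sumWords n (sumSplits (λ a → F (R ∷ a))) + sumWords n (sumSplits (λ a → F (U ∷ a))))
    ≡⟨ cong (sumWords (suc n) (F []) +_) (cong₂ _+_ (sumWords-sumSplits n _) (sumWords-sumSplits n _)) ⟩
  sumWords (suc n) (F []) + (sumAntidiagonal n (λ i j → sumWords i (λ a → sumWords j (F (R ∷ a))))
                             + sumAntidiagonal n (λ i j → sumWords i (λ a → sumWords j (F (U ∷ a)))))
    ≡⟨ cong (sumWords (suc n) (F []) +_) (sym (sumAntidiagonal-+ n _ _)) ⟩
  sumAntidiagonal (suc n) (λ i j → sumWords i (λ a → sumWords j (F a))) ∎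

[x+t]-t≡x : ∀ x t → x ℤ.+ t ℤ.- t ≡ x
[x+t]-t≡x = ℤ-Solver.solve-∀

+-cancelʳ-≤ : ∀ t {x y} → x ℤ.+ t ℤ.≤ y ℤ.+ t → x ℤ.≤ y
+-cancelʳ-≤ t {x} {y} le = subst₂ ℤ._≤_ ([x+t]-t≡x x t) ([x+t]-t≡x y t) (ℤₚ.+-monoˡ-≤ (- t) le)

+-cancelʳ-< : ∀ t {x y} → x ℤ.+ t ℤ.< y ℤ.+ t → x ℤ.< y
+-cancelʳ-< t {x} {y} lt = subst₂ ℤ._<_ ([x+t]-t≡x x t) ([x+t]-t≡x y t) (ℤₚ.+-monoˡ-< (- t) lt)

𝟙-≤-+ : ∀ x y t → 𝟙 (x ℤ.+ t ℤ.≤? y ℤ.+ t) ≡ 𝟙 (x ℤ.≤? y)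
𝟙-≤-+ x y t = 𝟙-cong (x ℤ.+ t ℤ.≤? y ℤ.+ t) (x ℤ.≤? y) (mk⇔ (+-cancelʳ-≤ t) (ℤₚ.+-monoˡ-≤ t))

𝟙-<-+ : ∀ x y t → 𝟙 (x ℤ.+ t ℤ.<? y ℤ.+ t) ≡ 𝟙 (x ℤ.<? y)
𝟙-<-+ x y t = 𝟙-cong (x ℤ.+ t ℤ.<? y ℤ.+ t) (x ℤ.<? y) (mk⇔ (+-cancelʳ-< t) (ℤₚ.+-monoˡ-< t))

𝟙-≤-⊓ : ∀ e x y → 𝟙 (e ℤ.≤? x ⊓ y) ≡ 𝟙 (e ℤ.≤? x) * 𝟙 (e ℤ.≤? y)
𝟙-≤-⊓ e x y = trans (𝟙-cong (e ℤ.≤? x ⊓ y) (e ℤ.≤? x ×-dec e ℤ.≤? y) (mk⇔ to (uncurry ℤₚ.⊓-glb)))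
                    (𝟙-× (e ℤ.≤? x) (e ℤ.≤? y))
  where
  to : e ℤ.≤ x ⊓ y → e ℤ.≤ x × e ℤ.≤ y
  to le = ℤₚ.≤-trans le (ℤₚ.i⊓j≤i x y) , ℤₚ.≤-trans le (ℤₚ.i⊓j≤j x y)

⊓-by-cases : ∀ (f : ℤ → ℕ) h μ → f h * 𝟙 (h ℤ.<? μ) + f μ * 𝟙 (μ ℤ.≤? h) ≡ f (h ⊓ μ)
⊓-by-cases f h μ with h ℤ.<? μ | μ ℤ.≤? h
... | yes h<μ | yes μ≤h = contradiction μ≤h (ℤₚ.<⇒≱ h<μ)
... | yes h<μ | no  _   = begin
  f h * 1 + f μ * 0 ≡⟨ a*1+b*0≡a (f h) (f μ) ⟩
  f h               ≡⟨ cong f (sym (ℤₚ.i≤j⇒i⊓j≡i (ℤₚ.<⇒≤ h<μ))) ⟩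
  f (h ⊓ μ)         ∎
  where
  a*1+b*0≡a : ∀ a b → a * 1 + b * 0 ≡ a
  a*1+b*0≡a = solve-∀
... | no  _   | yes μ≤h = begin
  f h * 0 + f μ * 1 ≡⟨ a*0+b*1≡b (f h) (f μ) ⟩
  f μ               ≡⟨ cong f (sym (ℤₚ.i≥j⇒i⊓j≡j μ≤h)) ⟩
  f (h ⊓ μ)         ∎
  where
  a*0+b*1≡b : ∀ a b → a * 0 + b * 1 ≡ b
  a*0+b*1≡b = solve-∀
... | no  h≮μ | no  μ≰h = contradiction (ℤₚ.≮⇒≥ h≮μ) μ≰h

-- Walks with steps +p and −q

#R : List Step → ℕ
#R []      = 0
#R (R ∷ w) = suc (#R w)
#R (U ∷ w) = #R w

#U : List Step → ℕ
#U []      = 0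
#U (R ∷ w) = #U w
#U (U ∷ w) = suc (#U w)

length≡#R+#U : ∀ w → length w ≡ #R w + #U w
length≡#R+#U []      = refl
length≡#R+#U (R ∷ w) = cong suc (length≡#R+#U w)
length≡#R+#U (U ∷ w) = trans (cong suc (length≡#R+#U w)) (sym (ℕₚ.+-suc (#R w) (#U w)))

sumWords-#U : ∀ n k → sumWords n (λ w → 𝟙 (#U w ≟ k)) ≡ n C k
sumWords-#U zero    zero    = refl
sumWords-#U zero    (suc k) = refl
sumWords-#U (suc n) zero    = cong₂ _+_ (sumWords-#U n 0) (sumWords-zero n (λ _ _ → refl))
sumWords-#U (suc n) (suc k) = begin
  sumWords n (λ w → 𝟙 (#U w ≟ suc k)) + sumWords n (λ w → 𝟙 (#U w ≟ k))
    ≡⟨ cong₂ _+_ (sumWords-#U n (suc k)) (sumWords-#U n k) ⟩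
  n C suc k + n C k ≡⟨ ℕₚ.+-comm (n C suc k) (n C k) ⟩
  n C k + n C suc k ≡⟨ nCk+nC[k+1]≡[n+1]C[k+1] n k ⟩
  suc n C suc k     ∎

module Walk (p q : ℕ) where

  stepHeight : Step → ℤ
  stepHeight R = ℤ.+ p
  stepHeight U = - ℤ.+ q

  endpoint : ℤ → List Step → ℤ
  endpoint h []      = h
  endpoint h (s ∷ w) = endpoint (h ℤ.+ stepHeight s) w

  lowest : ℤ → List Step → ℤ
  lowest h []      = h
  lowest h (s ∷ w) = h ⊓ lowest (h ℤ.+ stepHeight s) w

  staysAtOrAbove : ℤ → ℤ → List Step → ℕ
  staysAtOrAbove b h w = 𝟙 (b ℤ.≤? lowest h w)

  staysAboveStart : ℤ → List Step → ℕ
  staysAboveStart h []      = 1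
  staysAboveStart h (s ∷ w) = 𝟙 (h ℤ.<? lowest (h ℤ.+ stepHeight s) w)

  isZero : ℤ → ℕ
  isZero x = 𝟙 (x ℤ.≟ 0ℤ)

  endpoint-++ : ∀ h u v → endpoint h (u ++ v) ≡ endpoint (endpoint h u) v
  endpoint-++ h []      v = refl
  endpoint-++ h (s ∷ u) v = endpoint-++ (h ℤ.+ stepHeight s) u v

  private
    [h+t]+s≡[h+s]+t : ∀ h t s → h ℤ.+ t ℤ.+ s ≡ h ℤ.+ s ℤ.+ t
    [h+t]+s≡[h+s]+t = ℤ-Solver.solve-∀

  endpoint-+ : ∀ h t w → endpoint (h ℤ.+ t) w ≡ endpoint h w ℤ.+ t
  endpoint-+ h t []      = refl
  endpoint-+ h t (s ∷ w) =
    trans (cong (λ z → endpoint z w) ([h+t]+s≡[h+s]+t h t (stepHeight s))) (endpoint-+ (h ℤ.+ stepHeight s) t w)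

  lowest-+ : ∀ h t w → lowest (h ℤ.+ t) w ≡ lowest h w ℤ.+ t
  lowest-+ h t []      = refl
  lowest-+ h t (s ∷ w) = begin
    (h ℤ.+ t) ⊓ lowest (h ℤ.+ t ℤ.+ stepHeight s) w
      ≡⟨ cong (λ z → (h ℤ.+ t) ⊓ lowest z w) ([h+t]+s≡[h+s]+t h t (stepHeight s)) ⟩
    (h ℤ.+ t) ⊓ lowest (h ℤ.+ stepHeight s ℤ.+ t) w
      ≡⟨ cong ((h ℤ.+ t) ⊓_) (lowest-+ (h ℤ.+ stepHeight s) t w) ⟩
    (h ℤ.+ t) ⊓ (lowest (h ℤ.+ stepHeight s) w ℤ.+ t)
      ≡⟨ sym (ℤₚ.mono-≤-distrib-⊓ (ℤₚ.+-monoˡ-≤ t) h _) ⟩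
    h ⊓ lowest (h ℤ.+ stepHeight s) w ℤ.+ t ∎

  lowest≤start : ∀ h w → lowest h w ℤ.≤ h
  lowest≤start h []      = ℤₚ.≤-refl
  lowest≤start h (s ∷ w) = ℤₚ.i⊓j≤i h _

  lowest≤endpoint : ∀ h w → lowest h w ℤ.≤ endpoint h w
  lowest≤endpoint h []      = ℤₚ.≤-refl
  lowest≤endpoint h (s ∷ w) = ℤₚ.≤-trans (ℤₚ.i⊓j≤j h _) (lowest≤endpoint (h ℤ.+ stepHeight s) w)

  lowest-++ : ∀ h u v → lowest h (u ++ v) ≡ lowest h u ⊓ lowest (endpoint h u) v
  lowest-++ h []      v = sym (ℤₚ.i≥j⇒i⊓j≡j (lowest≤start h v))
  lowest-++ h (s ∷ u) v =
    trans (cong (h ⊓_) (lowest-++ (h ℤ.+ stepHeight s) u v)) (sym (ℤₚ.⊓-assoc h _ _))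

  staysAtOrAbove-∷ : ∀ b h s w →
    staysAtOrAbove b h (s ∷ w) ≡ 𝟙 (b ℤ.≤? h) * staysAtOrAbove b (h ℤ.+ stepHeight s) w
  staysAtOrAbove-∷ b h s w = 𝟙-≤-⊓ b h _

  staysAtOrAbove-++ : ∀ b h u v →
    staysAtOrAbove b h (u ++ v) ≡ staysAtOrAbove b h u * staysAtOrAbove b (endpoint h u) v
  staysAtOrAbove-++ b h u v = trans (cong (λ z → 𝟙 (b ℤ.≤? z)) (lowest-++ h u v)) (𝟙-≤-⊓ b _ _)

  staysAtOrAbove-+ : ∀ b h t w → staysAtOrAbove (b ℤ.+ t) (h ℤ.+ t) w ≡ staysAtOrAbove b h w
  staysAtOrAbove-+ b h t w =
    trans (cong (λ z → 𝟙 ((b ℤ.+ t) ℤ.≤? z)) (lowest-+ h t w)) (𝟙-≤-+ b (lowest h w) t)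

  staysAboveStart-+ : ∀ h t w → staysAboveStart (h ℤ.+ t) w ≡ staysAboveStart h w
  staysAboveStart-+ h t []      = refl
  staysAboveStart-+ h t (s ∷ w) = trans (cong (λ z → 𝟙 ((h ℤ.+ t) ℤ.<? z)) lowest-shift) (𝟙-<-+ h _ t)
    where
    lowest-shift : lowest (h ℤ.+ t ℤ.+ stepHeight s) w ≡ lowest (h ℤ.+ stepHeight s) w ℤ.+ t
    lowest-shift = trans (cong (λ z → lowest z w) ([h+t]+s≡[h+s]+t h t (stepHeight s)))
                         (lowest-+ (h ℤ.+ stepHeight s) t w)

  heightAt : ℕ → ℕ → ℤ
  heightAt x y = ℤ.+ (p * x) ℤ.- ℤ.+ (q * y)

  private
    +[k*suc[x]]≡+k++[k*x] : ∀ k x → ℤ.+ (k * suc x) ≡ ℤ.+ k ℤ.+ ℤ.+ (k * x)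
    +[k*suc[x]]≡+k++[k*x] k x = trans (cong ℤ.+_ (ℕₚ.*-suc k x)) (ℤₚ.pos-+ k (k * x))

  heightAt-R : ∀ x y → heightAt x y ℤ.+ stepHeight R ≡ heightAt (suc x) y
  heightAt-R x y = trans (a-b+c≡c+a-b (ℤ.+ (p * x)) (ℤ.+ (q * y)) (ℤ.+ p))
                         (cong (ℤ._- ℤ.+ (q * y)) (sym (+[k*suc[x]]≡+k++[k*x] p x)))
    where
    a-b+c≡c+a-b : ∀ a b c → a ℤ.- b ℤ.+ c ≡ c ℤ.+ a ℤ.- b
    a-b+c≡c+a-b = ℤ-Solver.solve-∀

  heightAt-U : ∀ x y → heightAt x y ℤ.+ stepHeight U ≡ heightAt x (suc y)
  heightAt-U x y = trans (a-b-c≡a-[c+b] (ℤ.+ (p * x)) (ℤ.+ (q * y)) (ℤ.+ q))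
                         (cong (λ z → ℤ.+ (p * x) ℤ.- z) (sym (+[k*suc[x]]≡+k++[k*x] q y)))
    where
    a-b-c≡a-[c+b] : ∀ a b c → a ℤ.- b ℤ.+ - c ≡ a ℤ.- (c ℤ.+ b)
    a-b-c≡a-[c+b] = ℤ-Solver.solve-∀

  heightAt-0-0 : heightAt 0 0 ≡ 0ℤ
  heightAt-0-0 rewrite ℕₚ.*-zeroʳ p | ℕₚ.*-zeroʳ q = refl

  isZero-heightAt : ∀ x y → isZero (heightAt x y) ≡ 𝟙 (p * x ≟ q * y)
  isZero-heightAt x y = 𝟙-cong (heightAt x y ℤ.≟ 0ℤ) (p * x ≟ q * y) (mk⇔
    (λ h≡0 → ℤₚ.+-injective (ℤₚ.i-j≡0⇒i≡j _ _ h≡0))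
    (λ px≡qy → trans (cong (λ z → ℤ.+ z ℤ.- ℤ.+ (q * y)) px≡qy) (ℤₚ.+-inverseʳ (ℤ.+ (q * y)))))

  endpoint-heightAt : ∀ x y w → endpoint (heightAt x y) w ≡ heightAt (x + #R w) (y + #U w)
  endpoint-heightAt x y []      = sym (cong₂ heightAt (ℕₚ.+-identityʳ x) (ℕₚ.+-identityʳ y))
  endpoint-heightAt x y (R ∷ w) = begin
    endpoint (heightAt x y ℤ.+ stepHeight R) w ≡⟨ cong (λ h → endpoint h w) (heightAt-R x y) ⟩
    endpoint (heightAt (suc x) y) w           ≡⟨ endpoint-heightAt (suc x) y w ⟩
    heightAt (suc x + #R w) (y + #U w)        ≡⟨ cong (λ z → heightAt z (y + #U w)) (sym (ℕₚ.+-suc x (#R w))) ⟩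
    heightAt (x + suc (#R w)) (y + #U w)      ∎
  endpoint-heightAt x y (U ∷ w) = begin
    endpoint (heightAt x y ℤ.+ stepHeight U) w ≡⟨ cong (λ h → endpoint h w) (heightAt-U x y) ⟩
    endpoint (heightAt x (suc y)) w           ≡⟨ endpoint-heightAt x (suc y) w ⟩
    heightAt (x + #R w) (suc y + #U w)        ≡⟨ cong (heightAt (x + #R w)) (sym (ℕₚ.+-suc y (#U w))) ⟩
    heightAt (x + #R w) (y + suc (#U w))      ∎

  endpoint-0 : ∀ w → endpoint 0ℤ w ≡ heightAt (#R w) (#U w)
  endpoint-0 w = trans (cong (λ h → endpoint h w) (sym heightAt-0-0)) (endpoint-heightAt 0 0 w)

  -- Cutting at the last minimum and the cycle lemma

  lastMinimumAt : ℤ → List Step → List Step → ℕ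
  lastMinimumAt h a c = staysAtOrAbove (endpoint h a) h a * staysAboveStart (endpoint h a) c

  -- Among the splits w = a ++ c only the one at the last minimum of w has lastMinimumAt h a c ≡ 1.
  sumSplits-lastMinimum : ∀ (φ : ℤ → ℤ → ℕ) h w →
    sumSplits (λ a c → φ (endpoint h a) (endpoint (endpoint h a) c) * lastMinimumAt h a c) w
      ≡ φ (lowest h w) (endpoint h w)
  sumSplits-lastMinimum φ h [] = begin
    φ h h * (𝟙 (h ℤ.≤? h) * 1) ≡⟨ cong (λ z → φ h h * (z * 1)) (𝟙-true (h ℤ.≤? h) ℤₚ.≤-refl) ⟩
    φ h h * 1                  ≡⟨ ℕₚ.*-identityʳ (φ h h) ⟩
    φ h h                      ∎
  sumSplits-lastMinimum φ h (s ∷ w) = begin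
    φ h X * (𝟙 (h ℤ.≤? h) * 𝟙 (h ℤ.<? μ)) + sumSplits (λ a c → F (s ∷ a) c) w
      ≡⟨ cong₂ _+_ (cong (λ z → φ h X * (z * 𝟙 (h ℤ.<? μ))) (𝟙-true (h ℤ.≤? h) ℤₚ.≤-refl))
                   (sumSplits-cong w peel) ⟩
    φ h X * (1 * 𝟙 (h ℤ.<? μ)) + sumSplits (λ a c → φ′ (e a) (endpoint (e a) c) * lastMinimumAt h′ a c) w
      ≡⟨ cong (φ h X * (1 * 𝟙 (h ℤ.<? μ)) +_) (sumSplits-lastMinimum φ′ h′ w) ⟩
    φ h X * (1 * 𝟙 (h ℤ.<? μ)) + φ μ X * 𝟙 (μ ℤ.≤? h)
      ≡⟨ cong (λ z → φ h X * z + φ μ X * 𝟙 (μ ℤ.≤? h)) (ℕₚ.*-identityˡ _) ⟩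
    φ h X * 𝟙 (h ℤ.<? μ) + φ μ X * 𝟙 (μ ℤ.≤? h)
      ≡⟨ ⊓-by-cases (λ x → φ x X) h μ ⟩
    φ (h ⊓ μ) X ∎
    where
    h′ = h ℤ.+ stepHeight s
    μ  = lowest h′ w
    X  = endpoint h′ w
    e : List Step → ℤ
    e a = endpoint h′ a
    F : List Step → List Step → ℕ
    F a c = φ (endpoint h a) (endpoint (endpoint h a) c) * lastMinimumAt h a c
    φ′ : ℤ → ℤ → ℕ
    φ′ x y = φ x y * 𝟙 (x ℤ.≤? h)
    peel : ∀ a c → F (s ∷ a) c ≡ φ′ (e a) (endpoint (e a) c) * lastMinimumAt h′ a c
    peel a c = begin
      φ (e a) Y * (staysAtOrAbove (e a) h (s ∷ a) * staysAboveStart (e a) c)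
        ≡⟨ cong (λ z → φ (e a) Y * (z * staysAboveStart (e a) c)) (staysAtOrAbove-∷ (e a) h s a) ⟩
      φ (e a) Y * (𝟙 (e a ℤ.≤? h) * staysAtOrAbove (e a) h′ a * staysAboveStart (e a) c)
        ≡⟨ x*[y*z*w]≡[x*y]*[z*w] (φ (e a) Y) (𝟙 (e a ℤ.≤? h)) _ _ ⟩
      φ′ (e a) Y * lastMinimumAt h′ a c ∎
      where
      Y = endpoint (e a) c
      x*[y*z*w]≡[x*y]*[z*w] : ∀ x y z w → x * (y * z * w) ≡ x * y * (z * w)
      x*[y*z*w]≡[x*y]*[z*w] = solve-∀

  endpoint-from : ∀ t w → endpoint t w ≡ endpoint 0ℤ w ℤ.+ t
  endpoint-from t w = trans (cong (λ z → endpoint z w) (sym (ℤₚ.+-identityˡ t))) (endpoint-+ 0ℤ t w)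

  isZero≡𝟙[0≤] : ∀ x → x ℤ.≤ 0ℤ → isZero x ≡ 𝟙 (0ℤ ℤ.≤? x)
  isZero≡𝟙[0≤] x x≤0 = 𝟙-cong (x ℤ.≟ 0ℤ) (0ℤ ℤ.≤? x)
    (mk⇔ (λ x≡0 → subst (0ℤ ℤ.≤_) (sym x≡0) ℤₚ.≤-refl) (ℤₚ.≤-antisym x≤0))

  dyckWord : List Step → ℕ
  dyckWord w = staysAtOrAbove 0ℤ 0ℤ w * isZero (endpoint 0ℤ w)

  dyckAboveZeroOn : List Step → List Step → ℕ
  dyckAboveZeroOn c v =
    staysAboveStart 0ℤ c * staysAtOrAbove 0ℤ (endpoint 0ℤ c) v * isZero (endpoint (endpoint 0ℤ c) v)

  -- Split u at the last return of u ++ v to height 0 inside u.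
  dyckWord-++ : ∀ u v → dyckWord (u ++ v) ≡ sumSplits (λ a c → dyckWord a * dyckAboveZeroOn c v) u
  dyckWord-++ u v = begin
    staysAtOrAbove 0ℤ 0ℤ (u ++ v) * isZero (endpoint 0ℤ (u ++ v))
      ≡⟨ cong₂ _*_ (staysAtOrAbove-++ 0ℤ 0ℤ u v) (cong isZero (endpoint-++ 0ℤ u v)) ⟩
    staysAtOrAbove 0ℤ 0ℤ u * staysAtOrAbove 0ℤ (endpoint 0ℤ u) v * isZero (endpoint (endpoint 0ℤ u) v)
      ≡⟨ ℕₚ.*-assoc (staysAtOrAbove 0ℤ 0ℤ u) _ _ ⟩
    staysAtOrAbove 0ℤ 0ℤ u * completes (endpoint 0ℤ u)
      ≡⟨ cong (_* completes (endpoint 0ℤ u)) (sym (isZero≡𝟙[0≤] (lowest 0ℤ u) (lowest≤start 0ℤ u))) ⟩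
    isZero (lowest 0ℤ u) * completes (endpoint 0ℤ u)
      ≡⟨ sym (sumSplits-lastMinimum (λ x y → isZero x * completes y) 0ℤ u) ⟩
    sumSplits (λ a c → isZero (endpoint 0ℤ a) * completes (endpoint (endpoint 0ℤ a) c) * lastMinimumAt 0ℤ a c) u
      ≡⟨ sumSplits-cong u split ⟩
    sumSplits (λ a c → dyckWord a * dyckAboveZeroOn c v) u ∎
    where
    completes : ℤ → ℕ
    completes x = staysAtOrAbove 0ℤ x v * isZero (endpoint x v)
    split : ∀ a c → isZero (endpoint 0ℤ a) * completes (endpoint (endpoint 0ℤ a) c) * lastMinimumAt 0ℤ a c
                    ≡ dyckWord a * dyckAboveZeroOn c v
    split a c = begin
      isZero e * completes (endpoint e c) * (staysAtOrAbove e 0ℤ a * staysAboveStart e c)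
        ≡⟨ ℕₚ.*-assoc (isZero e) _ _ ⟩
      isZero e * (completes (endpoint e c) * (staysAtOrAbove e 0ℤ a * staysAboveStart e c))
        ≡⟨ 𝟙-*-cong (e ℤ.≟ 0ℤ) (cong (λ x → completes (endpoint x c) * (staysAtOrAbove x 0ℤ a * staysAboveStart x c))) ⟩
      isZero e * (completes (endpoint 0ℤ c) * (staysAtOrAbove 0ℤ 0ℤ a * staysAboveStart 0ℤ c))
        ≡⟨ rearrange (isZero e) (staysAtOrAbove 0ℤ (endpoint 0ℤ c) v) _ (staysAtOrAbove 0ℤ 0ℤ a) _ ⟩
      staysAtOrAbove 0ℤ 0ℤ a * isZero e * dyckAboveZeroOn c v ∎
      where
      e = endpoint 0ℤ a
      rearrange : ∀ x y z w t → x * (y * z * (w * t)) ≡ w * x * (t * y * z)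
      rearrange = solve-∀

  -- A closed walk a ++ c cut at its last minimum rotates into the Dyck word c ++ a.
  lastMinimum-rotate : ∀ a c →
    isZero (endpoint (endpoint 0ℤ a) c) * lastMinimumAt 0ℤ a c ≡ dyckAboveZeroOn c a
  lastMinimum-rotate a c = begin
    isZero (endpoint X c) * (staysAtOrAbove X 0ℤ a * staysAboveStart X c)
      ≡⟨ cong (λ z → isZero z * (staysAtOrAbove X 0ℤ a * staysAboveStart X c))
              (trans (endpoint-from X c) (ℤₚ.+-comm Y X)) ⟩
    isZero (X ℤ.+ Y) * (staysAtOrAbove X 0ℤ a * staysAboveStart X c)
      ≡⟨ 𝟙-*-cong (X ℤ.+ Y ℤ.≟ 0ℤ) (λ X+Y≡0 → cong (λ x → staysAtOrAbove x 0ℤ a * staysAboveStart x c)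
                                                  (inverseˡ-unique X Y X+Y≡0)) ⟩
    isZero (X ℤ.+ Y) * (staysAtOrAbove (- Y) 0ℤ a * staysAboveStart (- Y) c)
      ≡⟨ cong₂ (λ x y → isZero (X ℤ.+ Y) * (x * y)) shift-start shift-level ⟩
    isZero (X ℤ.+ Y) * (staysAtOrAbove 0ℤ Y a * staysAboveStart 0ℤ c)
      ≡⟨ cong (λ z → isZero z * (staysAtOrAbove 0ℤ Y a * staysAboveStart 0ℤ c)) (sym (endpoint-from Y a)) ⟩
    isZero (endpoint Y a) * (staysAtOrAbove 0ℤ Y a * staysAboveStart 0ℤ c)
      ≡⟨ x*[y*z]≡z*y*x (isZero (endpoint Y a)) (staysAtOrAbove 0ℤ Y a) (staysAboveStart 0ℤ c) ⟩
    dyckAboveZeroOn c a ∎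
    where
    X = endpoint 0ℤ a
    Y = endpoint 0ℤ c
    shift-start : staysAtOrAbove (- Y) 0ℤ a ≡ staysAtOrAbove 0ℤ Y a
    shift-start = trans (cong₂ (λ x y → staysAtOrAbove x y a)
                               (sym (ℤₚ.+-identityˡ (- Y))) (sym (ℤₚ.+-inverseʳ Y)))
                        (staysAtOrAbove-+ 0ℤ Y (- Y) a)
    shift-level : staysAboveStart (- Y) c ≡ staysAboveStart 0ℤ c
    shift-level = trans (cong (λ x → staysAboveStart x c) (sym (ℤₚ.+-identityˡ (- Y)))) (staysAboveStart-+ 0ℤ (- Y) c)
    x*[y*z]≡z*y*x : ∀ x y z → x * (y * z) ≡ z * y * x
    x*[y*z]≡z*y*x = solve-∀

  dyckAboveZeroOn-[] : ∀ s w → dyckAboveZeroOn (s ∷ w) [] ≡ 0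
  dyckAboveZeroOn-[] s w with 0ℤ ℤ.<? lowest (0ℤ ℤ.+ stepHeight s) w
  ... | no  _   = refl
  ... | yes 0<μ = begin
    1 * 𝟙 (0ℤ ℤ.≤? X) * isZero X ≡⟨ cong (1 * 𝟙 (0ℤ ℤ.≤? X) *_) (𝟙-false (X ℤ.≟ 0ℤ) X≢0) ⟩
    1 * 𝟙 (0ℤ ℤ.≤? X) * 0        ≡⟨ ℕₚ.*-zeroʳ (1 * 𝟙 (0ℤ ℤ.≤? X)) ⟩
    0                            ∎
    where
    X = endpoint (0ℤ ℤ.+ stepHeight s) w
    X≢0 : ¬ X ≡ 0ℤ
    X≢0 X≡0 = ℤₚ.<-irrefl (sym X≡0) (ℤₚ.<-≤-trans 0<μ (lowest≤endpoint (0ℤ ℤ.+ stepHeight s) w))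

  dyckCount : ℕ → ℕ
  dyckCount n = sumWords n dyckWord

  bridgeCount : ℕ → ℕ
  bridgeCount n = sumWords n (λ w → isZero (endpoint 0ℤ w))

  dyckAboveZeroCount : ℕ → ℕ → ℕ
  dyckAboveZeroCount i j = sumWords i (λ c → sumWords j (dyckAboveZeroOn c))

  dyckCount-+ : ∀ j k → dyckCount (j + k) ≡ sumAntidiagonal j (λ i l → dyckCount i * dyckAboveZeroCount l k)
  dyckCount-+ j k = begin
    sumWords (j + k) dyckWord
      ≡⟨ sumWords-++ j k dyckWord ⟩
    sumWords j (λ u → sumWords k (λ v → dyckWord (u ++ v)))
      ≡⟨ sumWords-cong j (λ u _ → sumWords-cong k (λ v _ → dyckWord-++ u v)) ⟩
    sumWords j (λ u → sumWords k (λ v → sumSplits (λ a c → F a c v) u))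
      ≡⟨ sumWords-comm j k _ ⟩
    sumWords k (λ v → sumWords j (sumSplits (λ a c → F a c v)))
      ≡⟨ sumWords-cong k (λ v _ → sumWords-sumSplits j (λ a c → F a c v)) ⟩
    sumWords k (λ v → sumAntidiagonal j (λ i l → sumWords i (λ a → sumWords l (λ c → F a c v))))
      ≡⟨ sumWords-sumAntidiagonal k j _ ⟩
    sumAntidiagonal j (λ i l → sumWords k (λ v → sumWords i (λ a → sumWords l (λ c → F a c v))))
      ≡⟨ sumAntidiagonal-cong j (λ i l _ → factor i l) ⟩
    sumAntidiagonal j (λ i l → dyckCount i * dyckAboveZeroCount l k) ∎
    where
    F : List Step → List Step → List Step → ℕ
    F a c v = dyckWord a * dyckAboveZeroOn c v
    factor : ∀ i l → sumWords k (λ v → sumWords i (λ a → sumWords l (λ c → F a c v)))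
                     ≡ dyckCount i * dyckAboveZeroCount l k
    factor i l = begin
      sumWords k (λ v → sumWords i (λ a → sumWords l (λ c → F a c v)))
        ≡⟨ sumWords-comm k i _ ⟩
      sumWords i (λ a → sumWords k (λ v → sumWords l (λ c → F a c v)))
        ≡⟨ sumWords-cong i (λ a _ → trans (sumWords-cong k (λ v _ → sumWords-*ˡ l (dyckWord a) _))
                                          (sumWords-*ˡ k (dyckWord a) _)) ⟩
      sumWords i (λ a → dyckWord a * sumWords k (λ v → sumWords l (λ c → dyckAboveZeroOn c v)))
        ≡⟨ sumWords-*ʳ i _ dyckWord ⟩
      dyckCount i * sumWords k (λ v → sumWords l (λ c → dyckAboveZeroOn c v))
        ≡⟨ cong (dyckCount i *_) (sumWords-comm k l _) ⟩
      dyckCount i * dyckAboveZeroCount l k ∎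

  bridgeCount-rotate : ∀ n → bridgeCount n ≡ sumAntidiagonal n (λ i j → dyckAboveZeroCount j i)
  bridgeCount-rotate n = begin
    sumWords n (λ w → isZero (endpoint 0ℤ w))
      ≡⟨ sumWords-cong n (λ w _ → sym (sumSplits-lastMinimum (λ _ y → isZero y) 0ℤ w)) ⟩
    sumWords n (sumSplits (λ a c → isZero (endpoint (endpoint 0ℤ a) c) * lastMinimumAt 0ℤ a c))
      ≡⟨ sumWords-sumSplits n _ ⟩
    sumAntidiagonal n (λ i j → sumWords i (λ a → sumWords j (λ c →
      isZero (endpoint (endpoint 0ℤ a) c) * lastMinimumAt 0ℤ a c)))
      ≡⟨ sumAntidiagonal-cong n (λ i j _ →
           trans (sumWords-cong i (λ a _ → sumWords-cong j (λ c _ → lastMinimum-rotate a c)))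
                 (sumWords-comm i j _)) ⟩
    sumAntidiagonal n (λ i j → dyckAboveZeroCount j i) ∎

  dyckAboveZeroCount-[] : ∀ l → dyckAboveZeroCount (suc l) 0 ≡ 0
  dyckAboveZeroCount-[] l =
    cong₂ _+_ (sumWords-zero l (λ w _ → dyckAboveZeroOn-[] R w)) (sumWords-zero l (λ w _ → dyckAboveZeroOn-[] U w))

  bridgeCount-suc : ∀ r → bridgeCount (suc r) ≡ sumAntidiagonal r (λ i j → dyckAboveZeroCount i (suc j))
  bridgeCount-suc r = begin
    bridgeCount (suc r)
      ≡⟨ bridgeCount-rotate (suc r) ⟩
    dyckAboveZeroCount (suc r) 0 + sumAntidiagonal r (λ i j → dyckAboveZeroCount j (suc i))
      ≡⟨ cong (_+ sumAntidiagonal r (λ i j → dyckAboveZeroCount j (suc i))) (dyckAboveZeroCount-[] r) ⟩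
    sumAntidiagonal r (λ i j → dyckAboveZeroCount j (suc i))
      ≡⟨ sumAntidiagonal-comm r _ ⟩
    sumAntidiagonal r (λ i j → dyckAboveZeroCount i (suc j)) ∎

  cycle-lemma : ∀ M → suc M * dyckCount (suc M) ≡ sumAntidiagonal M (λ i j → bridgeCount (suc i) * dyckCount j)
  cycle-lemma M = begin
    suc M * dyckCount (suc M)
      ≡⟨ sym (sumAntidiagonal-const M (dyckCount (suc M))) ⟩
    sumAntidiagonal M (λ _ _ → dyckCount (suc M))
      ≡⟨ sumAntidiagonal-cong M (λ j k j+k≡M →
           trans (cong dyckCount (sym (trans (ℕₚ.+-suc j k) (cong suc j+k≡M)))) (dyckCount-+ j (suc k))) ⟩
    sumAntidiagonal M (λ j k → sumAntidiagonal j (λ x y → dyckCount x * dyckAboveZeroCount y (suc k)))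
      ≡⟨ sumAntidiagonal-assoc M (λ x y k → dyckCount x * dyckAboveZeroCount y (suc k)) ⟩
    sumAntidiagonal M (λ x r → sumAntidiagonal r (λ y k → dyckCount x * dyckAboveZeroCount y (suc k)))
      ≡⟨ sumAntidiagonal-cong M (λ x r _ → sumAntidiagonal-*ˡ r (dyckCount x) _) ⟩
    sumAntidiagonal M (λ x r → dyckCount x * sumAntidiagonal r (λ y k → dyckAboveZeroCount y (suc k)))
      ≡⟨ sumAntidiagonal-cong M (λ x r _ →
           trans (ℕₚ.*-comm (dyckCount x) _) (cong (_* dyckCount x) (sym (bridgeCount-suc r)))) ⟩
    sumAntidiagonal M (λ x r → bridgeCount (suc r) * dyckCount x)
      ≡⟨ sumAntidiagonal-comm M _ ⟩
    sumAntidiagonal M (λ i j → bridgeCount (suc i) * dyckCount j) ∎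

-- Lattice paths as walks

length-filter≡sum-𝟙 : ∀ {T : Set} {P : T → Set} (P? : ∀ x → Dec (P x)) xs →
                       length (filter P? xs) ≡ sum (map (λ x → 𝟙 (P? x)) xs)
length-filter≡sum-𝟙 P? []       = refl
length-filter≡sum-𝟙 P? (x ∷ xs) with P? x
... | yes _ = cong suc (length-filter≡sum-𝟙 P? xs)
... | no  _ = length-filter≡sum-𝟙 P? xs

sum-map-∷ : ∀ (f : List Step → ℕ) s xs → sum (map f (map (s ∷_) xs)) ≡ sum (map (λ w → f (s ∷ w)) xs)
sum-map-∷ f s xs = cong sum (sym (map-∘ xs))

sum-lattice-paths : ∀ r u (f : List Step → ℕ) →
  sum (map f (lattice-paths r u)) ≡ sumWords (r + u) (λ w → 𝟙 (#R w ≟ r) * 𝟙 (#U w ≟ u) * f w)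
sum-lattice-paths zero zero f = trans (ℕₚ.+-identityʳ (f [])) (sym (ℕₚ.+-identityʳ (f [])))
sum-lattice-paths zero (suc u) f = begin
  sum (map f (map (U ∷_) (lattice-paths 0 u)))
    ≡⟨ sum-map-∷ f U (lattice-paths 0 u) ⟩
  sum (map (λ w → f (U ∷ w)) (lattice-paths 0 u))
    ≡⟨ sum-lattice-paths 0 u _ ⟩
  sumWords u (λ w → 𝟙 (#R w ≟ 0) * 𝟙 (#U w ≟ u) * f (U ∷ w))
    ≡⟨ cong (_+ sumWords u (λ w → 𝟙 (#R w ≟ 0) * 𝟙 (#U w ≟ u) * f (U ∷ w)))
            (sym (sumWords-zero u (λ _ _ → refl))) ⟩
  sumWords (suc u) (λ w → 𝟙 (#R w ≟ 0) * 𝟙 (#U w ≟ suc u) * f w) ∎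
sum-lattice-paths (suc r) zero f = begin
  sum (map f (map (R ∷_) (lattice-paths r 0)))
    ≡⟨ sum-map-∷ f R (lattice-paths r 0) ⟩
  sum (map (λ w → f (R ∷ w)) (lattice-paths r 0))
    ≡⟨ sum-lattice-paths r 0 _ ⟩
  sumWords (r + 0) (λ w → 𝟙 (#R w ≟ r) * 𝟙 (#U w ≟ 0) * f (R ∷ w))
    ≡⟨ sym (ℕₚ.+-identityʳ _) ⟩
  sumWords (r + 0) (λ w → 𝟙 (#R w ≟ r) * 𝟙 (#U w ≟ 0) * f (R ∷ w)) + 0
    ≡⟨ cong (sumWords (r + 0) (λ w → 𝟙 (#R w ≟ r) * 𝟙 (#U w ≟ 0) * f (R ∷ w)) +_)
            (sym (sumWords-zero (r + 0) (λ w _ → cong (_* f (U ∷ w)) (ℕₚ.*-zeroʳ (𝟙 (#R w ≟ suc r)))))) ⟩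
  sumWords (suc r + 0) (λ w → 𝟙 (#R w ≟ suc r) * 𝟙 (#U w ≟ 0) * f w) ∎
sum-lattice-paths (suc r) (suc u) f = begin
  sum (map f (map (R ∷_) (lattice-paths r (suc u)) ++ map (U ∷_) (lattice-paths (suc r) u)))
    ≡⟨ cong sum (map-++ f (map (R ∷_) (lattice-paths r (suc u))) _) ⟩
  sum (map f (map (R ∷_) (lattice-paths r (suc u))) ++ map f (map (U ∷_) (lattice-paths (suc r) u)))
    ≡⟨ sum-++ (map f (map (R ∷_) (lattice-paths r (suc u)))) _ ⟩
  sum (map f (map (R ∷_) (lattice-paths r (suc u)))) + sum (map f (map (U ∷_) (lattice-paths (suc r) u)))
    ≡⟨ cong₂ _+_ (trans (sum-map-∷ f R (lattice-paths r (suc u))) (sum-lattice-paths r (suc u) _))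
                 (trans (sum-map-∷ f U (lattice-paths (suc r) u)) (sum-lattice-paths (suc r) u _)) ⟩
  sumWords (r + suc u) (λ w → g (R ∷ w)) + sumWords (suc r + u) (λ w → g (U ∷ w))
    ≡⟨ cong (λ n → sumWords (r + suc u) (λ w → g (R ∷ w)) + sumWords n (λ w → g (U ∷ w)))
            (sym (ℕₚ.+-suc r u)) ⟩
  sumWords (suc r + suc u) g ∎
  where
  g : List Step → ℕ
  g w = 𝟙 (#R w ≟ suc r) * 𝟙 (#U w ≟ suc u) * f w

module SameSlope (m n p q : ℕ) (same-slope : ∀ x y → m * y ≤ n * x ⇔ q * y ≤ p * x) where
  open Walk p q

  below⇔0≤heightAt : ∀ x y → m * y ≤ n * x ⇔ 0ℤ ℤ.≤ heightAt x y
  below⇔0≤heightAt x y = mk⇔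
    (λ below → ℤₚ.i≤j⇒0≤j-i (ℤ.+≤+ (Equivalence.to (same-slope x y) below)))
    (λ 0≤h → Equivalence.from (same-slope x y) (ℤₚ.drop‿+≤+ (ℤₚ.0≤i-j⇒j≤i 0≤h)))

  𝟙-allBelow? : ∀ x y w → 𝟙 (allBelow? m n x y w) ≡ staysAtOrAbove 0ℤ (heightAt x y) w
  𝟙-allBelow? x y [] =
    𝟙-cong (allBelow? m n x y []) (0ℤ ℤ.≤? heightAt x y)
           (mk⇔ (λ { (done below) → Equivalence.to (below⇔0≤heightAt x y) below })
                (λ 0≤h → done (Equivalence.from (below⇔0≤heightAt x y) 0≤h)))
  𝟙-allBelow? x y (R ∷ w) = begin
    𝟙 (allBelow? m n x y (R ∷ w))
      ≡⟨ 𝟙-cong (allBelow? m n x y (R ∷ w)) (m * y ≤? n * x ×-dec allBelow? m n (suc x) y w)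
                (mk⇔ (λ { (stepR below rest) → below , rest }) (uncurry stepR)) ⟩
    𝟙 (m * y ≤? n * x ×-dec allBelow? m n (suc x) y w)
      ≡⟨ 𝟙-× (m * y ≤? n * x) (allBelow? m n (suc x) y w) ⟩
    𝟙 (m * y ≤? n * x) * 𝟙 (allBelow? m n (suc x) y w)
      ≡⟨ cong₂ _*_ (𝟙-cong (m * y ≤? n * x) (0ℤ ℤ.≤? heightAt x y) (below⇔0≤heightAt x y))
                   (𝟙-allBelow? (suc x) y w) ⟩
    𝟙 (0ℤ ℤ.≤? heightAt x y) * staysAtOrAbove 0ℤ (heightAt (suc x) y) w
      ≡⟨ cong (λ h → 𝟙 (0ℤ ℤ.≤? heightAt x y) * staysAtOrAbove 0ℤ h w) (sym (heightAt-R x y)) ⟩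
    𝟙 (0ℤ ℤ.≤? heightAt x y) * staysAtOrAbove 0ℤ (heightAt x y ℤ.+ stepHeight R) w
      ≡⟨ sym (staysAtOrAbove-∷ 0ℤ (heightAt x y) R w) ⟩
    staysAtOrAbove 0ℤ (heightAt x y) (R ∷ w) ∎
  𝟙-allBelow? x y (U ∷ w) = begin
    𝟙 (allBelow? m n x y (U ∷ w))
      ≡⟨ 𝟙-cong (allBelow? m n x y (U ∷ w)) (m * y ≤? n * x ×-dec allBelow? m n x (suc y) w)
                (mk⇔ (λ { (stepU below rest) → below , rest }) (uncurry stepU)) ⟩
    𝟙 (m * y ≤? n * x ×-dec allBelow? m n x (suc y) w)
      ≡⟨ 𝟙-× (m * y ≤? n * x) (allBelow? m n x (suc y) w) ⟩
    𝟙 (m * y ≤? n * x) * 𝟙 (allBelow? m n x (suc y) w)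
      ≡⟨ cong₂ _*_ (𝟙-cong (m * y ≤? n * x) (0ℤ ℤ.≤? heightAt x y) (below⇔0≤heightAt x y))
                   (𝟙-allBelow? x (suc y) w) ⟩
    𝟙 (0ℤ ℤ.≤? heightAt x y) * staysAtOrAbove 0ℤ (heightAt x (suc y)) w
      ≡⟨ cong (λ h → 𝟙 (0ℤ ℤ.≤? heightAt x y) * staysAtOrAbove 0ℤ h w) (sym (heightAt-U x y)) ⟩
    𝟙 (0ℤ ℤ.≤? heightAt x y) * staysAtOrAbove 0ℤ (heightAt x y ℤ.+ stepHeight U) w
      ≡⟨ sym (staysAtOrAbove-∷ 0ℤ (heightAt x y) U w) ⟩
    staysAtOrAbove 0ℤ (heightAt x y) (U ∷ w) ∎

  Cat≡sumWords : Cat m n ≡ sumWords (m + n) (λ w → 𝟙 (#R w ≟ m) * 𝟙 (#U w ≟ n) * staysAtOrAbove 0ℤ 0ℤ w)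
  Cat≡sumWords = begin
    length (filter (isDyck? m n) (lattice-paths m n))
      ≡⟨ length-filter≡sum-𝟙 (isDyck? m n) (lattice-paths m n) ⟩
    sum (map (λ w → 𝟙 (isDyck? m n w)) (lattice-paths m n))
      ≡⟨ sum-lattice-paths m n _ ⟩
    sumWords (m + n) (λ w → 𝟙 (#R w ≟ m) * 𝟙 (#U w ≟ n) * 𝟙 (allBelow? m n 0 0 w))
      ≡⟨ sumWords-cong (m + n) (λ w _ → cong (𝟙 (#R w ≟ m) * 𝟙 (#U w ≟ n) *_)
           (trans (𝟙-allBelow? 0 0 w) (cong (λ h → staysAtOrAbove 0ℤ h w) heightAt-0-0))) ⟩
    sumWords (m + n) (λ w → 𝟙 (#R w ≟ m) * 𝟙 (#U w ≟ n) * staysAtOrAbove 0ℤ 0ℤ w) ∎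

-- Coprime slopes

module Slope (a b : ℕ) {{_ : NonZero a}} where
  open Walk b a

  balanced⇒ : ∀ k r u → r + u ≡ k * a + k * b → b * r ≡ a * u → r ≡ k * a
  balanced⇒ k r u r+u≡ br≡au = ℕₚ.*-cancelˡ-≡ r (k * a) (a + b) {{a+b≢0}} (begin
    (a + b) * r         ≡⟨ ℕₚ.*-distribʳ-+ r a b ⟩
    a * r + b * r       ≡⟨ cong (a * r +_) br≡au ⟩
    a * r + a * u       ≡⟨ sym (ℕₚ.*-distribˡ-+ a r u) ⟩
    a * (r + u)         ≡⟨ cong (a *_) r+u≡ ⟩
    a * (k * a + k * b) ≡⟨ solve-∀′ a b k ⟩
    (a + b) * (k * a)   ∎)
    where
    a+b≢0 : NonZero (a + b)
    a+b≢0 = >-nonZero (ℕₚ.<-≤-trans (>-nonZero⁻¹ a) (ℕₚ.m≤m+n a b))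
    solve-∀′ : ∀ a b k → a * (k * a + k * b) ≡ (a + b) * (k * a)
    solve-∀′ = solve-∀

  isZero-endpoint : ∀ k w → length w ≡ k * a + k * b →
                    isZero (endpoint 0ℤ w) ≡ 𝟙 (#R w ≟ k * a) * 𝟙 (#U w ≟ k * b)
  isZero-endpoint k w |w| = begin
    isZero (endpoint 0ℤ w)              ≡⟨ cong isZero (endpoint-0 w) ⟩
    isZero (heightAt (#R w) (#U w))     ≡⟨ isZero-heightAt (#R w) (#U w) ⟩
    𝟙 (b * #R w ≟ a * #U w)             ≡⟨ 𝟙-cong (b * #R w ≟ a * #U w) (#R w ≟ k * a ×-dec #U w ≟ k * b)
                                                  (mk⇔ to from) ⟩
    𝟙 (#R w ≟ k * a ×-dec #U w ≟ k * b) ≡⟨ 𝟙-× (#R w ≟ k * a) (#U w ≟ k * b) ⟩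
    𝟙 (#R w ≟ k * a) * 𝟙 (#U w ≟ k * b) ∎
    where
    #R+#U≡ : #R w + #U w ≡ k * a + k * b
    #R+#U≡ = trans (sym (length≡#R+#U w)) |w|
    to : b * #R w ≡ a * #U w → #R w ≡ k * a × #U w ≡ k * b
    to br≡au = #R≡ , ℕₚ.+-cancelˡ-≡ (k * a) (#U w) (k * b) (trans (cong (_+ #U w) (sym #R≡)) #R+#U≡)
      where #R≡ = balanced⇒ k (#R w) (#U w) #R+#U≡ br≡au
    from : #R w ≡ k * a × #U w ≡ k * b → b * #R w ≡ a * #U w
    from (#R≡ , #U≡) = begin
      b * #R w    ≡⟨ cong (b *_) #R≡ ⟩
      b * (k * a) ≡⟨ solve-∀′ a b k ⟩
      a * (k * b) ≡⟨ cong (a *_) (sym #U≡) ⟩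
      a * #U w    ∎
      where
      solve-∀′ : ∀ a b k → b * (k * a) ≡ a * (k * b)
      solve-∀′ = solve-∀

  bridgeCount-multiple : ∀ k → bridgeCount (k * (a + b)) ≡ (k * a + k * b) C (k * b)
  bridgeCount-multiple k = begin
    sumWords (k * (a + b)) (λ w → isZero (endpoint 0ℤ w))
      ≡⟨ cong (λ n → sumWords n (λ w → isZero (endpoint 0ℤ w))) (ℕₚ.*-distribˡ-+ k a b) ⟩
    sumWords (k * a + k * b) (λ w → isZero (endpoint 0ℤ w))
      ≡⟨ sumWords-cong (k * a + k * b) (λ w |w| →
           trans (isZero-endpoint k w |w|)
                 (𝟙-≟-determined (#R w) (#U w) (k * a) (k * b) (trans (sym (length≡#R+#U w)) |w|))) ⟩
    sumWords (k * a + k * b) (λ w → 𝟙 (#U w ≟ k * b))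
      ≡⟨ sumWords-#U (k * a + k * b) (k * b) ⟩
    (k * a + k * b) C (k * b) ∎

  bridgeCount-vanish : Coprime a b → ∀ n → ¬ (a + b) ∣ n → bridgeCount n ≡ 0
  bridgeCount-vanish coprime n a+b∤n = sumWords-zero n (λ w |w| →
    trans (cong isZero (endpoint-0 w))
          (trans (isZero-heightAt (#R w) (#U w)) (𝟙-false (b * #R w ≟ a * #U w) (unbalanced w |w|))))
    where
    unbalanced : ∀ w → length w ≡ n → ¬ b * #R w ≡ a * #U w
    unbalanced w |w| br≡au = a+b∤n (coprime-divisor (coprime-+ (Coprimality.sym coprime)) (divides (#R w) (begin
      a * n               ≡⟨ cong (a *_) (trans (sym |w|) (length≡#R+#U w)) ⟩
      a * (#R w + #U w)   ≡⟨ ℕₚ.*-distribˡ-+ a (#R w) (#U w) ⟩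
      a * #R w + a * #U w ≡⟨ cong (a * #R w +_) (sym br≡au) ⟩
      a * #R w + b * #R w ≡⟨ sym (ℕₚ.*-distribʳ-+ (#R w) a b) ⟩
      (a + b) * #R w      ≡⟨ ℕₚ.*-comm (a + b) (#R w) ⟩
      #R w * (a + b)      ∎)))

  dyckCount-multiple : ∀ k → dyckCount (k * (a + b)) ≡ Cat (k * a) (k * b)
  dyckCount-multiple zero    = refl
  dyckCount-multiple (suc k′) = begin
    sumWords (k * (a + b)) dyckWord
      ≡⟨ cong (λ n → sumWords n dyckWord) (ℕₚ.*-distribˡ-+ k a b) ⟩
    sumWords (k * a + k * b) dyckWord
      ≡⟨ sumWords-cong (k * a + k * b) (λ w |w| →
           trans (cong (staysAtOrAbove 0ℤ 0ℤ w *_) (isZero-endpoint k w |w|))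
                 (ℕₚ.*-comm (staysAtOrAbove 0ℤ 0ℤ w) _)) ⟩
    sumWords (k * a + k * b) (λ w → 𝟙 (#R w ≟ k * a) * 𝟙 (#U w ≟ k * b) * staysAtOrAbove 0ℤ 0ℤ w)
      ≡⟨ sym (SameSlope.Cat≡sumWords (k * a) (k * b) b a same-slope) ⟩
    Cat (k * a) (k * b) ∎
    where
    k = suc k′
    same-slope : ∀ x y → k * a * y ≤ k * b * x ⇔ a * y ≤ b * x
    same-slope x y = mk⇔
      (λ le → ℕₚ.*-cancelˡ-≤ k (subst₂ _≤_ (ℕₚ.*-assoc k a y) (ℕₚ.*-assoc k b x) le))
      (λ le → subst₂ _≤_ (sym (ℕₚ.*-assoc k a y)) (sym (ℕₚ.*-assoc k b x)) (ℕₚ.*-monoʳ-≤ k le))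

-- Collecting the terms of the cycle lemma

sum1toℕ : ℕ → (ℕ → ℕ) → ℕ
sum1toℕ zero    f = 0
sum1toℕ (suc n) f = sum1toℕ n f + f (suc n)

sum1toℕ-cong : ∀ n {f g : ℕ → ℕ} → (∀ i → 1 ≤ i → i ≤ n → f i ≡ g i) →
               sum1toℕ n f ≡ sum1toℕ n g
sum1toℕ-cong zero    f≗g = refl
sum1toℕ-cong (suc n) f≗g =
  cong₂ _+_ (sum1toℕ-cong n (λ i 1≤i i≤n → f≗g i 1≤i (ℕₚ.m≤n⇒m≤1+n i≤n)))
            (f≗g (suc n) (s≤s z≤n) ℕₚ.≤-refl)

sum1toℕ-zero : ∀ n {f : ℕ → ℕ} → (∀ i → 1 ≤ i → i ≤ n → f i ≡ 0) → sum1toℕ n f ≡ 0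
sum1toℕ-zero zero    f≗0 = refl
sum1toℕ-zero (suc n) f≗0 =
  cong₂ _+_ (sum1toℕ-zero n (λ i 1≤i i≤n → f≗0 i 1≤i (ℕₚ.m≤n⇒m≤1+n i≤n)))
            (f≗0 (suc n) (s≤s z≤n) ℕₚ.≤-refl)

sum1toℕ-+ : ∀ m n f → sum1toℕ (m + n) f ≡ sum1toℕ m f + sum1toℕ n (λ j → f (m + j))
sum1toℕ-+ m zero    f rewrite ℕₚ.+-identityʳ m = sym (ℕₚ.+-identityʳ _)
sum1toℕ-+ m (suc n) f rewrite ℕₚ.+-suc m n =
  trans (cong (_+ f (suc (m + n))) (sum1toℕ-+ m n f)) (ℕₚ.+-assoc (sum1toℕ m f) _ _)

sumAntidiagonal-sum1toℕ : ∀ M (f : ℕ → ℕ → ℕ) →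
  sumAntidiagonal M (λ i j → f (suc i) j) ≡ sum1toℕ (suc M) (λ i → f i (suc M ∸ i))
sumAntidiagonal-sum1toℕ zero    f = refl
sumAntidiagonal-sum1toℕ (suc M) f = begin
  sumAntidiagonal (suc M) (λ i j → f (suc i) j)
    ≡⟨ sumAntidiagonal-last M (λ i j → f (suc i) j) ⟩
  sumAntidiagonal M (λ i j → f (suc i) (suc j)) + f (suc (suc M)) 0
    ≡⟨ cong (_+ f (suc (suc M)) 0) (sumAntidiagonal-sum1toℕ M (λ i j → f i (suc j))) ⟩
  sum1toℕ (suc M) (λ i → f i (suc (suc M ∸ i))) + f (suc (suc M)) 0
    ≡⟨ cong₂ _+_ (sum1toℕ-cong (suc M) (λ i _ i≤1+M → cong (f i) (sym (ℕₚ.+-∸-assoc 1 i≤1+M))))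
                 (cong (f (suc (suc M))) (sym (ℕₚ.n∸n≡0 (suc M)))) ⟩
  sum1toℕ (suc (suc M)) (λ i → f i (suc (suc M) ∸ i)) ∎

sum1toℕ-multiples : ∀ s d (f : ℕ → ℕ) → (∀ i → ¬ suc s ∣ i → f i ≡ 0) →
                    sum1toℕ (d * suc s) f ≡ sum1toℕ d (λ i → f (i * suc s))
sum1toℕ-multiples s zero    f f≗0 = refl
sum1toℕ-multiples s (suc d) f f≗0 = begin
  sum1toℕ (suc s + d * suc s) f
    ≡⟨ cong (λ n → sum1toℕ n f) (ℕₚ.+-comm (suc s) (d * suc s)) ⟩
  sum1toℕ (d * suc s + suc s) f
    ≡⟨ sum1toℕ-+ (d * suc s) (suc s) f ⟩
  sum1toℕ (d * suc s) f + (sum1toℕ s (λ j → f (d * suc s + j)) + f (d * suc s + suc s))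
    ≡⟨ cong₂ (λ x y → x + (y + f (d * suc s + suc s)))
             (sum1toℕ-multiples s d f f≗0)
             (sum1toℕ-zero s (λ j 1≤j j≤s → f≗0 (d * suc s + j) (between-multiples j 1≤j j≤s))) ⟩
  sum1toℕ d (λ i → f (i * suc s)) + (0 + f (d * suc s + suc s))
    ≡⟨ cong (λ n → sum1toℕ d (λ i → f (i * suc s)) + f n) (ℕₚ.+-comm (d * suc s) (suc s)) ⟩
  sum1toℕ (suc d) (λ i → f (i * suc s)) ∎
  where
  between-multiples : ∀ j → 1 ≤ j → j ≤ s → ¬ suc s ∣ d * suc s + j
  between-multiples (suc j) _ j<1+s 1+s∣ = ℕₚ.<⇒≱ (s≤s j<1+s) (∣⇒≤ (∣m+n∣m⇒∣n 1+s∣ (n∣m*n d)))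

Cat-convolution : ∀ a b d → .{{NonZero a}} → Coprime a b →
  d * (a + b) * Cat (d * a) (d * b)
    ≡ sum1toℕ d (λ i → ((i * a + i * b) C (i * b)) * Cat ((d ∸ i) * a) ((d ∸ i) * b))
Cat-convolution a@(suc a′) b zero    coprime = refl
Cat-convolution a@(suc a′) b d@(suc d′) coprime = begin
  N * Cat (d * a) (d * b)
    ≡⟨ cong (N *_) (sym (dyckCount-multiple d)) ⟩
  N * dyckCount N
    ≡⟨ cycle-lemma M ⟩
  sumAntidiagonal M (λ i j → bridgeCount (suc i) * dyckCount j)
    ≡⟨ sumAntidiagonal-sum1toℕ M (λ i j → bridgeCount i * dyckCount j) ⟩
  sum1toℕ N (λ L → bridgeCount L * dyckCount (N ∸ L))
    ≡⟨ sum1toℕ-multiples (a′ + b) d _ (λ L a+b∤L →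
         cong (_* dyckCount (N ∸ L)) (bridgeCount-vanish coprime L a+b∤L)) ⟩
  sum1toℕ d (λ i → bridgeCount (i * (a + b)) * dyckCount (N ∸ i * (a + b)))
    ≡⟨ sum1toℕ-cong d (λ i _ _ → cong₂ _*_ (bridgeCount-multiple i) (complement i)) ⟩
  sum1toℕ d (λ i → ((i * a + i * b) C (i * b)) * Cat ((d ∸ i) * a) ((d ∸ i) * b)) ∎
  where
  open Walk b a
  open Slope a b
  N = d * (a + b)
  M = a′ + b + d′ * (a + b)  -- N reduces to suc M
  complement : ∀ i → dyckCount (N ∸ i * (a + b)) ≡ Cat ((d ∸ i) * a) ((d ∸ i) * b)
  complement i = trans (cong dyckCount (sym (ℕₚ.*-distribʳ-∸ (a + b) d i))) (dyckCount-multiple (d ∸ i))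

frac-cross : ∀ x y z w → x * suc w ≡ z * suc y → frac x (suc y) ≡ frac z (suc w)
frac-cross x y z w xw≡zy = ℚₚ.fromℚᵘ-cong {mkℚᵘ (ℤ.+ x) y} {mkℚᵘ (ℤ.+ z) w} (*≡* (begin
  ℤ.+ x ℤ.* ℤ.+ suc w ≡⟨ sym (ℤₚ.pos-* x (suc w)) ⟩
  ℤ.+ (x * suc w)     ≡⟨ cong ℤ.+_ xw≡zy ⟩
  ℤ.+ (z * suc y)     ≡⟨ ℤₚ.pos-* z (suc y) ⟩
  ℤ.+ z ℤ.* ℤ.+ suc y ∎))

toℚᵘ-frac : ∀ x y → toℚᵘ (frac x (suc y)) ≃ mkℚᵘ (ℤ.+ x) y
toℚᵘ-frac x y = ℚₚ.toℚᵘ-fromℚᵘ (mkℚᵘ (ℤ.+ x) y)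

frac-* : ∀ x y z w → frac x (suc y) *ℚ frac z (suc w) ≡ frac (x * z) (suc y * suc w)
frac-* x y z w = ℚₚ.toℚᵘ-injective (ℚᵘₚ.≃-trans (ℚₚ.toℚᵘ-homo-* (frac x (suc y)) (frac z (suc w)))
  (ℚᵘₚ.≃-trans (ℚᵘₚ.*-cong (toℚᵘ-frac x y) (toℚᵘ-frac z w))
  (ℚᵘₚ.≃-trans (*≡* (cong (ℤ._* ℤ.+ (suc y * suc w)) (sym (ℤₚ.pos-* x z))))
               (ℚᵘₚ.≃-sym (toℚᵘ-frac (x * z) (w + y * suc w))))))

frac-+ : ∀ x z y → frac x (suc y) +ℚ frac z (suc y) ≡ frac (x + z) (suc y)
frac-+ x z y = ℚₚ.toℚᵘ-injective (ℚᵘₚ.≃-trans (ℚₚ.toℚᵘ-homo-+ (frac x (suc y)) (frac z (suc y)))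
  (ℚᵘₚ.≃-trans (ℚᵘₚ.+-cong (toℚᵘ-frac x y) (toℚᵘ-frac z y))
  (ℚᵘₚ.≃-trans (*≡* cross) (ℚᵘₚ.≃-sym (toℚᵘ-frac (x + z) y)))))
  where
  [xs+zs]s≡[x+z][ss] : ∀ x z s → (x ℤ.* s ℤ.+ z ℤ.* s) ℤ.* s ≡ (x ℤ.+ z) ℤ.* (s ℤ.* s)
  [xs+zs]s≡[x+z][ss] = ℤ-Solver.solve-∀
  cross : (ℤ.+ x ℤ.* ℤ.+ suc y ℤ.+ ℤ.+ z ℤ.* ℤ.+ suc y) ℤ.* ℤ.+ suc y
          ≡ ℤ.+ (x + z) ℤ.* ℤ.+ (suc y * suc y)
  cross = trans ([xs+zs]s≡[x+z][ss] (ℤ.+ x) (ℤ.+ z) (ℤ.+ suc y))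
                (sym (cong₂ ℤ._*_ (ℤₚ.pos-+ x z) (ℤₚ.pos-* (suc y) (suc y))))

sum1to-frac : ∀ d y (f : ℕ → ℚ) (g : ℕ → ℕ) → (∀ i → 1 ≤ i → i ≤ d → f i ≡ frac (g i) (suc y)) →
              sum1to d f ≡ frac (sum1toℕ d g) (suc y)
sum1to-frac zero    y f g f≗g = sym (ℚₚ.0/n≡0 (suc y))
sum1to-frac (suc d) y f g f≗g = begin
  sum1to d f +ℚ f (suc d)
    ≡⟨ cong₂ _+ℚ_ (sum1to-frac d y f g (λ i 1≤i i≤d → f≗g i 1≤i (ℕₚ.m≤n⇒m≤1+n i≤d)))
                  (f≗g (suc d) (s≤s z≤n) ℕₚ.≤-refl) ⟩
  frac (sum1toℕ d g) (suc y) +ℚ frac (g (suc d)) (suc y)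
    ≡⟨ frac-+ (sum1toℕ d g) (g (suc d)) y ⟩
  frac (sum1toℕ (suc d) g) (suc y) ∎

DivisorExpansion : ℕ → ℕ → ℕ → Set
DivisorExpansion m n d =
  fromℕ (Cat m n) ≡
    sum1to d (λ i → frac i d *ℚ A ((i * m) div d) ((i * n) div d)
                      *ℚ fromℕ (Cat (((d ∸ i) * m) div d) (((d ∸ i) * n) div d)))

divisorExpansion : ∀ a b d → .{{NonZero a}} → .{{NonZero d}} → Coprime a b → DivisorExpansion (a * d) (b * d) d
divisorExpansion a@(suc a′) b d@(suc d′) coprime = begin
  fromℕ (Cat (a * d) (b * d))
    ≡⟨ cong₂ (λ x y → fromℕ (Cat x y)) (ℕₚ.*-comm a d) (ℕₚ.*-comm b d) ⟩
  frac (Cat (d * a) (d * b)) 1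
    ≡⟨ frac-cross (Cat (d * a) (d * b)) 0 (sum1toℕ d g) N-1 cleared ⟩
  frac (sum1toℕ d g) N
    ≡⟨ sym (sum1to-frac d N-1 _ g term) ⟩
  sum1to d (λ i → frac i d *ℚ A ((i * (a * d)) div d) ((i * (b * d)) div d)
                    *ℚ fromℕ (Cat (((d ∸ i) * (a * d)) div d) (((d ∸ i) * (b * d)) div d))) ∎
  where
  N-1 = a′ + b + d′ * suc (a′ + b)
  N = suc N-1
  g : ℕ → ℕ
  g i = ((i * a + i * b) C (i * b)) * Cat ((d ∸ i) * a) ((d ∸ i) * b)
  cleared : Cat (d * a) (d * b) * N ≡ sum1toℕ d g * 1
  cleared = trans (ℕₚ.*-comm (Cat (d * a) (d * b)) N)
                  (trans (Cat-convolution a b d coprime) (sym (ℕₚ.*-identityʳ _)))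
  [i*[c*d]]/d≡i*c : ∀ i c → (i * (c * d)) div d ≡ i * c
  [i*[c*d]]/d≡i*c i c = trans (cong (_div d) (sym (ℕₚ.*-assoc i c d))) (m*n/n≡m (i * c) d)
  term : ∀ i → 1 ≤ i → i ≤ d →
    frac i d *ℚ A ((i * (a * d)) div d) ((i * (b * d)) div d)
      *ℚ fromℕ (Cat (((d ∸ i) * (a * d)) div d) (((d ∸ i) * (b * d)) div d))
    ≡ frac (g i) N
  term i@(suc _) _ _ = begin
    frac i d *ℚ A ((i * (a * d)) div d) ((i * (b * d)) div d)
      *ℚ fromℕ (Cat (((d ∸ i) * (a * d)) div d) (((d ∸ i) * (b * d)) div d))
      ≡⟨ cong₂ (λ u v → frac i d *ℚ u *ℚ fromℕ v)
               (cong₂ A ([i*[c*d]]/d≡i*c i a) ([i*[c*d]]/d≡i*c i b))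
               (cong₂ Cat ([i*[c*d]]/d≡i*c (d ∸ i) a) ([i*[c*d]]/d≡i*c (d ∸ i) b)) ⟩
    frac i d *ℚ A (i * a) (i * b) *ℚ fromℕ Cᵢ
      ≡⟨ cong (_*ℚ fromℕ Cᵢ) (frac-* i d′ Bᵢ _) ⟩
    frac (i * Bᵢ) (d * (i * a + i * b)) *ℚ fromℕ Cᵢ
      ≡⟨ frac-* (i * Bᵢ) _ Cᵢ 0 ⟩
    frac (i * Bᵢ * Cᵢ) (d * (i * a + i * b) * 1)
      ≡⟨ frac-cross (i * Bᵢ * Cᵢ) _ (Bᵢ * Cᵢ) N-1 (i-cancels i Bᵢ Cᵢ d a b) ⟩
    frac (g i) N ∎
    where
    Bᵢ = (i * a + i * b) C (i * b)
    Cᵢ = Cat ((d ∸ i) * a) ((d ∸ i) * b)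
    i-cancels : ∀ i x y d a b → i * x * y * (d * (a + b)) ≡ x * y * (d * (i * a + i * b) * 1)
    i-cancels = solve-∀

proposition3p1 : (m n : ℕ) → NonZero m → NonZero n →
    let d = gcd m n in
    fromℕ (Cat m n) ≡
      sum1to d (λ i → frac i d *ℚ A ((i * m) div d) ((i * n) div d)
                        *ℚ fromℕ (Cat (((d ∸ i) * m) div d) (((d ∸ i) * n) div d)))
proposition3p1 m n m≢0 _ =
  subst₂ (λ m′ n′ → DivisorExpansion m′ n′ d) (sym m≡a*d) (sym n≡b*d)
         (divisorExpansion a b d (coprime-/gcd m n))
  where
  instance
    d≢0 : NonZero (gcd m n)
    d≢0 = ≢-nonZero (gcd[m,n]≢0 m n (inj₁ (≢-nonZero⁻¹ m {{m≢0}})))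
  d = gcd m n
  a = m / d
  b = n / d
  m≡a*d : m ≡ a * d
  m≡a*d = sym (m/n*n≡m (gcd[m,n]∣m m n))
  n≡b*d : n ≡ b * d
  n≡b*d = sym (m/n*n≡m (gcd[m,n]∣n m n))
  instance
    a≢0 : NonZero a
    a≢0 = ℕₚ.m*n≢0⇒m≢0 a {{subst NonZero m≡a*d m≢0}}
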